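{- Let $G$ be a finite graph on $n$ vertices and let $k_1,k_2$ be natural numbers. If $\mathcal{B}_{\geq k_1}(G)\cong\mathcal{B}_{\geq k_2}(G)$, then either $k_i>n$ for both $i\in\{1,2\}$, or $\chi(G)<k_i\le n$ for both $i\in\{1,2\}$ and $k_1=k_2$, or $k_i\le\chi(G)$ for both $i\in\{1,2\}$.
   Context: Graphs are finite and simple; $\chi$ is the chromatic number. An independent set partition of $G$ is a partition of $V(G)$ into nonempty independent sets (parts). For such a partition $P$ and $v\in V(G)$, let $P-v$ be the partition of $V(G)\setminus\{v\}$ obtained by deleting $v$ from its part (discarding that part if empty). The Bell colouring graph $\mathcal{B}(G)$ has as vertices the independent set partitions of $G$, with $P\neq Q$ adjacent iff $P-v=Q-v$ for some $v\in V(G)$; $\mathcal{B}_{\geq k}(G)$ is its induced subgraph on partitions with at least $k$ parts (the graph with no vertices if none exist). -}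

module Defs where

open import Data.Nat using (ℕ; _≤_)
open import Data.Bool using (Bool; true; false; T; _∧_; _≟_)
open import Data.Fin using (Fin; _<_; _<?_)
open import Data.Fin.Properties using (all?)
open import Data.Vec using (Vec; lookup)
open import Data.List using (List; length; filter)
open import Data.List.Base using (allFin)
open import Data.Product using (Σ; ∃; _×_)
open import Relation.Nullary using (¬_; Dec; yes; no)
open import Relation.Nullary.Decidable using (⌊_⌋; _→-dec_; _×-dec_)
open import Relation.Binary.PropositionalEquality using (_≡_; _≢_)
open import Function.Bundles using (_↔_; Inverse; _⇔_)
open import Level using (0ℓ)

record Graph (n : ℕ) : Set where
  field
    adj    : Fin n → Fin n → Bool
    sym    : ∀ i j → adj i j ≡ adj j i
    irrefl : ∀ i → adj i i ≡ false
open Graph public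

Colouring : ∀ {n} → Graph n → ℕ → Set
Colouring {n} G k = Σ (Fin n → Fin k) λ f → ∀ i j → adj G i j ≡ true → f i ≢ f j

IsChromaticNumber : ∀ {n} → Graph n → ℕ → Set
IsChromaticNumber G c = Colouring G c × (∀ k → Colouring G k → c ≤ k)

-- A partition of Fin n is encoded (canonically) by its equivalence relation,
-- as an n×n Boolean matrix: rel M i j = true iff i, j lie in the same part.
Rel : ℕ → Set
Rel n = Vec (Vec Bool n) n

rel : ∀ {n} → Rel n → Fin n → Fin n → Bool
rel M i j = lookup (lookup M i) j

isIndepPartition : ∀ {n} → Graph n → Rel n → Bool
isIndepPartition {n} G M =
  ⌊ all? (λ i → rel M i i ≟ true) ⌋
  ∧ ⌊ all? (λ i → all? (λ j → rel M i j ≟ rel M j i)) ⌋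
  ∧ ⌊ all? (λ i → all? (λ j → all? (λ k →
        (rel M i j ≟ true) →-dec ((rel M j k ≟ true) →-dec (rel M i k ≟ true))))) ⌋
  ∧ ⌊ all? (λ i → all? (λ j → (rel M i j ≟ true) →-dec (adj G i j ≟ false))) ⌋

-- Number of parts = number of vertices that are the least element of their part.
numParts : ∀ {n} → Rel n → ℕ
numParts {n} M =
  length (filter (λ i → all? (λ j → (j <? i) →-dec (rel M i j ≟ false))) (allFin n))

record AbsGraph : Set₁ where
  field
    Vtx : Set
    Adj : Vtx → Vtx → Set
open AbsGraph public

_≅_ : AbsGraph → AbsGraph → Set
H₁ ≅ H₂ = Σ (Vtx H₁ ↔ Vtx H₂) λ f →
  ∀ u v → Adj H₁ u v ⇔ Adj H₂ (Inverse.to f u) (Inverse.to f v)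

BellVtx : ∀ {n} → Graph n → ℕ → Set
BellVtx {n} G k = Σ (Rel n) λ M → T (isIndepPartition G M) × (k ≤ numParts M)

-- P ~ Q iff P ≠ Q and P - v = Q - v for some vertex v, i.e. the induced
-- partitions of V(G) \ {v} coincide.
BellAdj : ∀ {n} (G : Graph n) (k : ℕ) → BellVtx G k → BellVtx G k → Set
BellAdj {n} G k P Q =
  P ≢ Q × ∃ λ (v : Fin n) → ∀ i j → i ≢ v → j ≢ v →
    rel (Data.Product.proj₁ P) i j ≡ rel (Data.Product.proj₁ Q) i j

Bell≥ : ∀ {n} → Graph n → ℕ → AbsGraph
Bell≥ G k = record { Vtx = BellVtx G k ; Adj = BellAdj G k }

{-# OPTIONS --safe #-}
module Submission where

open import Defs hiding (sym)
open import Data.Nat using (ℕ; _≤_; _<_)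
open import Data.Product using (_×_)
open import Data.Sum using (_⊎_)
open import Relation.Binary.PropositionalEquality using (_≡_)

open import Data.Bool using (true; false; T)
open import Data.Bool.Properties using (T-∧; ¬-not; T-irrelevant)
open import Data.Fin as Fin using (Fin; toℕ; fromℕ<; combine)
open import Data.Fin.Properties as Finₚ
  using (all?; combine-injective; toℕ-injective; toℕ-fromℕ<; injective⇒≤; ℕ→Fin-notInjective;
         2↔Bool)
open import Data.List using (List; []; _∷_; length; filter; lookup; allFin)
open import Data.List.Membership.Propositional.Properties using (∈-filter⁻; ∈-lookup)
open import Data.List.Properties using (filter-all; length-tabulate)
open import Data.List.Relation.Unary.All as All using (All; []; _∷_)
open import Data.List.Relation.Unary.Unique.Propositional using (Unique; []; _∷_)
open import Data.List.Relation.Unary.Unique.Propositional.Properties using (allFin⁺; filter⁺)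
open import Data.Nat using (zero; suc; _^_; z≤n; s≤s; _≤?_; _<?_)
open import Data.Nat.GeneralisedArithmetic using (fold)
open import Data.Nat.Properties
  using (≤-refl; ≤-trans; <-trans; ≤-<-trans; <⇒≤; m≤n⇒m≤1+n; m<n⇒m<1+n; ≤-pred; ≰⇒>; ≮⇒≥; <⇒≱;
         <-cmp; ≤-irrelevant)
open import Data.Product using (Σ; ∃; _,_; proj₁; proj₂; swap)
open import Data.Sum using (inj₁; inj₂; [_,_]′)
open import Data.Sum.Properties using (≡-dec; inj₁-injective; inj₂-injective)
open import Data.Vec using (Vec; []; _∷_; tabulate)
open import Data.Vec.Properties using (lookup∘tabulate)
open import Function
  using (_∘_; id; case_of_; Injective; _↣_; _⇔_; Inverse; Equivalence; mk⇔; Injection)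
open import Function.Properties.Inverse using (↔-sym; ↔⇒↣)
open import Relation.Binary.Definitions using (DecidableEquality; tri<; tri≈; tri>)
open import Relation.Binary.PropositionalEquality
  using (module ≡-Reasoning; _≢_; refl; sym; trans; cong; cong₂; subst; subst₂)
open import Relation.Nullary using (¬_; yes; no; does; contradiction)
open import Relation.Nullary.Decidable using (dec-false; does-⇔; fromWitness; _→-dec_)
open import Relation.Unary using (Pred; Decidable)
open import Level using (0ℓ)

-- An isomorphism B≥k₁(G) ≅ B≥k₂(G) is used only as a bijection of vertex sets. For k₁ < k₂ the
-- vertices of B≥k₂ are among those of B≥k₁, so by finiteness no independent set partition can
-- have between k₁ and k₂ - 1 parts. Such a partition exists once k₁ ≤ n and χ < k₂: colour the
-- vertices below t by a χ-colouring and leave the others as singletons. As t runs from 0 to n the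
-- number of parts goes from n down to at most χ, dropping by at most one per step, so it meets
-- [k₁, k₂).

module _ {A : Set} {N : ℕ} {encode : A → Fin N} (encode-injective : Injective _≡_ _≡_ encode) where

  -- Dedekind-finiteness: the iterates of f from a missed point are pairwise distinct.
  injective⇒¬misses : (f : A → A) → Injective _≡_ _≡_ f → (p : A) → ¬ (∀ x → f x ≢ p)
  injective⇒¬misses f f-injective p misses =
    ℕ→Fin-notInjective (encode ∘ fold p f) (iterates-injective ∘ encode-injective)
    where
    iterates-injective : Injective _≡_ _≡_ (fold p f)
    iterates-injective {zero}  {zero}  _  = refl
    iterates-injective {zero}  {suc j} eq = contradiction (sym eq) (misses _)
    iterates-injective {suc i} {zero}  eq = contradiction eq (misses _)
    iterates-injective {suc i} {suc j} eq = cong suc (iterates-injective (f-injective eq))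

encodeVec : ∀ {A : Set} {k m} → (A → Fin k) → Vec A m → Fin (k ^ m)
encodeVec e []       = Fin.zero
encodeVec e (x ∷ xs) = combine (e x) (encodeVec e xs)

encodeVec-injective : ∀ {A : Set} {k m} {e : A → Fin k} →
  Injective _≡_ _≡_ e → Injective _≡_ _≡_ (encodeVec {m = m} e)
encodeVec-injective e-injective {[]}     {[]}     _  = refl
encodeVec-injective e-injective {x ∷ xs} {y ∷ ys} eq
  with ex≡ey , exs≡eys ← combine-injective _ _ _ _ eq
  = cong₂ _∷_ (e-injective ex≡ey) (encodeVec-injective e-injective exs≡eys)

encodeRel : ∀ {n} → Rel n → Fin ((2 ^ n) ^ n)
encodeRel = encodeVec (encodeVec (Inverse.from 2↔Bool))

encodeRel-injective : ∀ {n} → Injective _≡_ _≡_ (encodeRel {n})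
encodeRel-injective =
  encodeVec-injective (encodeVec-injective (Injection.injective (↔⇒↣ (↔-sym 2↔Bool))))

module _ {A : Set} where

  Unique⇒lookup-injective : ∀ {xs : List A} → Unique xs → Injective _≡_ _≡_ (lookup xs)
  Unique⇒lookup-injective (_ ∷ _)      {Fin.zero}  {Fin.zero}  _  = refl
  Unique⇒lookup-injective (x∉xs ∷ _)   {Fin.zero}  {Fin.suc j} eq =
    contradiction eq (All.lookup x∉xs (∈-lookup j))
  Unique⇒lookup-injective (x∉xs ∷ _)   {Fin.suc i} {Fin.zero}  eq =
    contradiction (sym eq) (All.lookup x∉xs (∈-lookup i))
  Unique⇒lookup-injective (_ ∷ unique) {Fin.suc i} {Fin.suc j} eq =
    cong Fin.suc (Unique⇒lookup-injective unique eq)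

  module _ {P Q : Pred A 0ℓ} (P? : Decidable P) (Q? : Decidable Q) where

    length-filter-mono : ∀ {xs} → All (λ x → P x → Q x) xs →
      length (filter P? xs) ≤ length (filter Q? xs)
    length-filter-mono {[]}     []            = z≤n
    length-filter-mono {x ∷ xs} (P⇒Q ∷ P⇒Qs) with P? x | Q? x
    ... | yes _  | yes _  = s≤s (length-filter-mono P⇒Qs)
    ... | yes Px | no ¬Qx = contradiction (P⇒Q Px) ¬Qx
    ... | no _   | yes _  = m≤n⇒m≤1+n (length-filter-mono P⇒Qs)
    ... | no _   | no _   = length-filter-mono P⇒Qs

    length-filter-≤-suc : ∀ {xs} {t : A} → Unique xs → (∀ x → x ≢ t → P x → Q x) →
      length (filter P? xs) ≤ suc (length (filter Q? xs))
    length-filter-≤-suc {[]}     _            _   = z≤n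
    length-filter-≤-suc {x ∷ xs} (x∉xs ∷ unique) P⇒Q with P? x | Q? x
    ... | yes _  | yes _  = s≤s (length-filter-≤-suc unique P⇒Q)
    ... | no _   | yes _  = m≤n⇒m≤1+n (length-filter-≤-suc unique P⇒Q)
    ... | no _   | no _   = length-filter-≤-suc unique P⇒Q
    ... | yes Px | no ¬Qx = s≤s (length-filter-mono (All.map y≢t⇒ x∉xs))
      where
      -- x itself must be the exception t, so no other element of xs is
      y≢t⇒ : ∀ {y} → x ≢ y → P y → Q y
      y≢t⇒ {y} x≢y = P⇒Q y λ y≡t → ¬Qx (P⇒Q x (λ x≡t → x≢y (trans x≡t (sym y≡t))) Px)

module _ {n : ℕ} where

  LeastOfPart : Rel n → Pred (Fin n) 0ℓ
  LeastOfPart M i = ∀ j → j Fin.< i → rel M i j ≡ false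

  leastOfPart? : (M : Rel n) → Decidable (LeastOfPart M)
  leastOfPart? M i = all? (λ j → (j Fin.<? i) →-dec (rel M i j Data.Bool.≟ false))

  leastsOfParts : Rel n → List (Fin n)
  leastsOfParts M = filter (leastOfPart? M) (allFin n)

  leastOfPart-unique : ∀ {M i j} → LeastOfPart M i → LeastOfPart M j →
    rel M i j ≡ true → rel M j i ≡ true → i ≡ j
  leastOfPart-unique {i = i} {j} i-least j-least i~j j~i with Finₚ.<-cmp i j
  ... | tri< i<j _ _ = contradiction (trans (sym j~i) (j-least i i<j)) λ ()
  ... | tri≈ _ i≡j _ = i≡j
  ... | tri> _ _ j<i = contradiction (trans (sym i~j) (i-least j j<i)) λ ()

  numParts-≤-colouring : ∀ {m} (M : Rel n) (f : Fin n → Fin m) →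
    (∀ i j → f i ≡ f j → rel M i j ≡ true) → numParts M ≤ m
  numParts-≤-colouring M f same-colour = injective⇒≤ {f = f ∘ lookup (leastsOfParts M)} injective
    where
    least : ∀ a → LeastOfPart M (lookup (leastsOfParts M) a)
    least a = proj₂ (∈-filter⁻ (leastOfPart? M) {xs = allFin n} (∈-lookup a))

    injective : Injective _≡_ _≡_ (f ∘ lookup (leastsOfParts M))
    injective {a} {b} eq = Unique⇒lookup-injective (filter⁺ (leastOfPart? M) (allFin⁺ n))
      (leastOfPart-unique {M} (least a) (least b) (same-colour _ _ eq) (same-colour _ _ (sym eq)))

  numParts≡n : ∀ M → (∀ i → LeastOfPart M i) → numParts M ≡ n
  numParts≡n M all-least = trans
    (cong length (filter-all (leastOfPart? M) (All.universal all-least (allFin n))))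
    (length-tabulate id)

  numParts-≤-suc : ∀ M M′ (v : Fin n) → (∀ i → i ≢ v → LeastOfPart M i → LeastOfPart M′ i) →
    numParts M ≤ suc (numParts M′)
  numParts-≤-suc M M′ v = length-filter-≤-suc (leastOfPart? M) (leastOfPart? M′) (allFin⁺ n)

isIndepPartition-intro : ∀ {n} (G : Graph n) (M : Rel n) →
  (∀ i → rel M i i ≡ true) →
  (∀ i j → rel M i j ≡ rel M j i) →
  (∀ i j k → rel M i j ≡ true → rel M j k ≡ true → rel M i k ≡ true) →
  (∀ i j → rel M i j ≡ true → adj G i j ≡ false) →
  T (isIndepPartition G M)
isIndepPartition-intro G M reflexive symmetric transitive independent =
  ∧-intro (fromWitness {a? = all? _} reflexive) (∧-intro (fromWitness {a? = all? _} symmetric)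
    (∧-intro (fromWitness {a? = all? _} transitive) (fromWitness {a? = all? _} independent)))
  where
  ∧-intro : ∀ {x y} → T x → T y → T (x Data.Bool.∧ y)
  ∧-intro tx ty = Equivalence.from T-∧ (tx , ty)

module _ {n : ℕ} {L : Set} (_≟_ : DecidableEquality L) where

  partitionBy : (Fin n → L) → Rel n
  partitionBy h = tabulate λ i → tabulate λ j → does (h i ≟ h j)

  rel-partitionBy : ∀ h i j → rel (partitionBy h) i j ≡ does (h i ≟ h j)
  rel-partitionBy h i j
    rewrite lookup∘tabulate (λ i → tabulate λ j → does (h i ≟ h j)) i = lookup∘tabulate _ j

  rel-partitionBy-true : ∀ {h i j} → rel (partitionBy h) i j ≡ true ⇔ h i ≡ h j
  rel-partitionBy-true {h} {i} {j} rewrite rel-partitionBy h i j with h i ≟ h j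
  ... | yes hi≡hj = mk⇔ (λ _ → hi≡hj) (λ _ → refl)
  ... | no hi≢hj  = mk⇔ (λ ()) (λ hi≡hj → contradiction hi≡hj hi≢hj)

  rel-partitionBy-false : ∀ {h i j} → h i ≢ h j → rel (partitionBy h) i j ≡ false
  rel-partitionBy-false {h} {i} {j} hi≢hj =
    trans (rel-partitionBy h i j) (dec-false (h i ≟ h j) hi≢hj)

  partitionBy-isIndepPartition : ∀ (G : Graph n) h → (∀ i j → adj G i j ≡ true → h i ≢ h j) →
    T (isIndepPartition G (partitionBy h))
  partitionBy-isIndepPartition G h proper = isIndepPartition-intro G (partitionBy h)
    (λ i → related refl)
    (λ i j → trans (rel-partitionBy h i j)
               (trans (does-⇔ (mk⇔ sym sym) (h i ≟ h j) (h j ≟ h i)) (sym (rel-partitionBy h j i))))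
    (λ i j k i~j j~k → related (trans (same-label i~j) (same-label j~k)))
    (λ i j i~j → ¬-not λ adjacent → proper i j adjacent (same-label i~j))
    where
    related : ∀ {i j} → h i ≡ h j → rel (partitionBy h) i j ≡ true
    related = Equivalence.from rel-partitionBy-true
    same-label : ∀ {i j} → rel (partitionBy h) i j ≡ true → h i ≡ h j
    same-label = Equivalence.to rel-partitionBy-true

  leastOfPart-partitionBy : ∀ {h i} → LeastOfPart (partitionBy h) i ⇔ (∀ j → j Fin.< i → h i ≢ h j)
  leastOfPart-partitionBy = mk⇔
    (λ least j j<i hi≡hj →
      contradiction (trans (sym (Equivalence.from rel-partitionBy-true hi≡hj)) (least j j<i)) λ ())
    (λ distinct j j<i → rel-partitionBy-false (distinct j j<i))

discrete-intermediate-value : ∀ {k₁ k₂} (a : ℕ → ℕ) M → (∀ t → t < M → a t ≤ suc (a (suc t))) →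
  k₁ < k₂ → k₁ ≤ a 0 → a M < k₂ → ∃ λ t → k₁ ≤ a t × a t < k₂
discrete-intermediate-value a zero    _    _     k₁≤a₀ a₀<k₂ = 0 , k₁≤a₀ , a₀<k₂
discrete-intermediate-value {k₂ = k₂} a (suc M) step k₁<k₂ k₁≤a₀ aM<k₂ with a 0 <? k₂
... | yes a₀<k₂ = 0 , k₁≤a₀ , a₀<k₂
... | no a₀≮k₂ = Data.Product.map suc id
  (discrete-intermediate-value (a ∘ suc) M (λ t → step (suc t) ∘ s≤s) k₁<k₂ k₁≤a₁ aM<k₂)
  where
  k₁≤a₁ : _ ≤ a 1
  k₁≤a₁ = ≤-pred (≤-trans k₁<k₂ (≤-trans (≮⇒≥ a₀≮k₂) (step 0 (s≤s z≤n))))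

module Staged {n c : ℕ} (G : Graph n) (colouring : Colouring G c) where

  open Σ colouring renaming (proj₁ to col; proj₂ to proper)

  Label : Set
  Label = Fin c ⊎ Fin n

  _≟ₗ_ : DecidableEquality Label
  _≟ₗ_ = ≡-dec Finₚ._≟_ Finₚ._≟_

  stagedLabel : ℕ → Fin n → Label
  stagedLabel t i with toℕ i <? t
  ... | yes _ = inj₁ (col i)
  ... | no _  = inj₂ i

  staged : ℕ → Rel n
  staged t = partitionBy _≟ₗ_ (stagedLabel t)

  stagedLabel-coloured : ∀ {t i} → toℕ i < t → stagedLabel t i ≡ inj₁ (col i)
  stagedLabel-coloured {t} {i} i<t with toℕ i <? t
  ... | yes _   = refl
  ... | no i≮t = contradiction i<t i≮t

  stagedLabel-fresh : ∀ {t i} → t ≤ toℕ i → stagedLabel t i ≡ inj₂ i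
  stagedLabel-fresh {t} {i} t≤i with toℕ i <? t
  ... | yes i<t = contradiction t≤i (<⇒≱ i<t)
  ... | no _    = refl

  stagedLabel≡inj₂ : ∀ {t i j} → stagedLabel t j ≡ inj₂ i → j ≡ i
  stagedLabel≡inj₂ {t} {j = j} with toℕ j <? t
  ... | yes _ = λ ()
  ... | no _  = inj₂-injective

  stagedLabel-proper : ∀ t i j → adj G i j ≡ true → stagedLabel t i ≢ stagedLabel t j
  stagedLabel-proper t i j adjacent with toℕ i <? t | toℕ j <? t
  ... | yes _ | yes _ = proper i j adjacent ∘ inj₁-injective
  ... | yes _ | no _  = λ ()
  ... | no _  | yes _ = λ ()
  ... | no _  | no _  = λ i≡j → contradiction
    (trans (sym adjacent) (subst (λ k → adj G i k ≡ false) (inj₂-injective i≡j) (irrefl G i))) λ ()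

  staged-isIndepPartition : ∀ t → T (isIndepPartition G (staged t))
  staged-isIndepPartition t =
    partitionBy-isIndepPartition _≟ₗ_ G (stagedLabel t) (stagedLabel-proper t)

  staged-fresh-least : ∀ {t i} → t ≤ toℕ i → LeastOfPart (staged t) i
  staged-fresh-least {t} t≤i =
    Equivalence.from (leastOfPart-partitionBy _≟ₗ_ {stagedLabel t}) λ j j<i same →
    Finₚ.<⇒≢ j<i (stagedLabel≡inj₂ (trans (sym same) (stagedLabel-fresh t≤i)))

  staged-coloured-least : ∀ {t i} → toℕ i < t →
    LeastOfPart (staged t) i → LeastOfPart (staged (suc t)) i
  staged-coloured-least {t} {i} i<t least =
    Equivalence.from (leastOfPart-partitionBy _≟ₗ_ {stagedLabel (suc t)}) λ j j<i →
    subst₂ _≢_ (unchanged i ≤-refl) (unchanged j (<⇒≤ j<i))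
      (Equivalence.to (leastOfPart-partitionBy _≟ₗ_ {stagedLabel t}) least j j<i)
    where
    unchanged : ∀ k → toℕ k ≤ toℕ i → stagedLabel t k ≡ stagedLabel (suc t) k
    unchanged k k≤i = trans (stagedLabel-coloured (≤-<-trans k≤i i<t))
                            (sym (stagedLabel-coloured (m<n⇒m<1+n (≤-<-trans k≤i i<t))))

  numParts-staged-zero : numParts (staged 0) ≡ n
  numParts-staged-zero = numParts≡n (staged 0) λ i → staged-fresh-least z≤n

  numParts-staged-n : numParts (staged n) ≤ c
  numParts-staged-n = numParts-≤-colouring (staged n) col λ i j coli≡colj →
    Equivalence.from (rel-partitionBy-true _≟ₗ_ {stagedLabel n} {i} {j}) (begin
      stagedLabel n i ≡⟨ stagedLabel-coloured (Finₚ.toℕ<n i) ⟩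
      inj₁ (col i)    ≡⟨ cong inj₁ coli≡colj ⟩
      inj₁ (col j)    ≡⟨ sym (stagedLabel-coloured (Finₚ.toℕ<n j)) ⟩
      stagedLabel n j ∎)
    where open ≡-Reasoning

  numParts-staged-step : ∀ t → t < n → numParts (staged t) ≤ suc (numParts (staged (suc t)))
  numParts-staged-step t t<n = numParts-≤-suc (staged t) (staged (suc t)) (fromℕ< t<n) λ i i≢t →
    case <-cmp (toℕ i) t of λ where
      (tri< i<t _ _) → staged-coloured-least i<t
      (tri≈ _ i≡t _) → contradiction (toℕ-injective (trans i≡t (sym (toℕ-fromℕ< t<n)))) i≢t
      (tri> _ _ t<i) → λ _ → staged-fresh-least t<i

  partition-with-numParts-between : ∀ {k₁ k₂} → k₁ < k₂ → k₁ ≤ n → c < k₂ →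
    Σ (BellVtx G k₁) λ P → numParts (proj₁ P) < k₂
  partition-with-numParts-between k₁<k₂ k₁≤n c<k₂
    with t , k₁≤ , <k₂ ← discrete-intermediate-value (numParts ∘ staged) n numParts-staged-step
                           k₁<k₂ (subst (_ ≤_) (sym numParts-staged-zero) k₁≤n)
                           (≤-<-trans numParts-staged-n c<k₂)
    = (staged t , staged-isIndepPartition t , k₁≤) , <k₂

module _ {n : ℕ} (G : Graph n) where

  BellVtx-≡ : ∀ {k} {P Q : BellVtx G k} → proj₁ P ≡ proj₁ Q → P ≡ Q
  BellVtx-≡ {P = M , indep , many} {.M , indep′ , many′} refl =
    cong₂ (λ indep many → M , indep , many) (T-irrelevant indep indep′) (≤-irrelevant many many′)

  BellVtx-weaken : ∀ {k₁ k₂} → k₁ ≤ k₂ → BellVtx G k₂ → BellVtx G k₁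
  BellVtx-weaken k₁≤k₂ (M , indep , many) = M , indep , ≤-trans k₁≤k₂ many

  BellVtx-no-injection : ∀ {k₁ k₂} → k₁ ≤ k₂ → (P : BellVtx G k₁) → numParts (proj₁ P) < k₂ →
    ¬ (BellVtx G k₁ ↣ BellVtx G k₂)
  BellVtx-no-injection k₁≤k₂ P few φ = injective⇒¬misses
    {encode = encodeRel ∘ proj₁} (BellVtx-≡ ∘ encodeRel-injective)
    (BellVtx-weaken k₁≤k₂ ∘ to) (injective ∘ BellVtx-≡ ∘ cong proj₁) P
    λ Q weakened≡P →
      <⇒≱ few (subst (λ M → _ ≤ numParts M) (cong proj₁ weakened≡P) (proj₂ (proj₂ (to Q))))
    where open Injection φ using (to; injective)

  Bell≥-no-injection : ∀ {c k₁ k₂} → Colouring G c → k₁ < k₂ → k₁ ≤ n → c < k₂ →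
    ¬ (BellVtx G k₁ ↣ BellVtx G k₂)
  Bell≥-no-injection colouring k₁<k₂ k₁≤n c<k₂ =
    let P , few = Staged.partition-with-numParts-between G colouring k₁<k₂ k₁≤n c<k₂
    in BellVtx-no-injection (<⇒≤ k₁<k₂) P few

outside-window : ∀ {n c a b} → a < b → ¬ (a ≤ n × c < b) → (n < a × n < b) ⊎ (a ≤ c × b ≤ c)
outside-window {n} {c} {a} {b} a<b not-inside with a ≤? n | c <? b
... | no a≰n  | _       = inj₁ (≰⇒> a≰n , <-trans (≰⇒> a≰n) a<b)
... | yes a≤n | yes c<b = contradiction (a≤n , c<b) not-inside
... | yes _   | no c≮b  = inj₂ (≤-trans (<⇒≤ a<b) (≮⇒≥ c≮b) , ≮⇒≥ c≮b)

diagonal : ∀ n c k →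
  (n < k × n < k) ⊎ ((c < k × k ≤ n) × (c < k × k ≤ n) × k ≡ k) ⊎ (k ≤ c × k ≤ c)
diagonal n c k with k ≤? n | c <? k
... | no k≰n  | _       = inj₁ (≰⇒> k≰n , ≰⇒> k≰n)
... | yes k≤n | yes c<k = inj₂ (inj₁ ((c<k , k≤n) , (c<k , k≤n) , refl))
... | yes _   | no c≮k  = inj₂ (inj₂ (≮⇒≥ c≮k , ≮⇒≥ c≮k))

lemma2p23 : (n : ℕ) (G : Graph n) (c : ℕ) → IsChromaticNumber G c →
    (k₁ k₂ : ℕ) → Bell≥ G k₁ ≅ Bell≥ G k₂ →
      (n < k₁ × n < k₂)
      ⊎ ((c < k₁ × k₁ ≤ n) × (c < k₂ × k₂ ≤ n) × k₁ ≡ k₂)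
      ⊎ (k₁ ≤ c × k₂ ≤ c)
lemma2p23 n G c (colouring , _) k₁ k₂ (bij , _) with <-cmp k₁ k₂
... | tri< k₁<k₂ _ _ = [ inj₁ , inj₂ ∘ inj₂ ]′ (outside-window k₁<k₂ λ (k₁≤n , c<k₂) →
        Bell≥-no-injection G colouring k₁<k₂ k₁≤n c<k₂ (↔⇒↣ bij))
... | tri≈ _ refl _ = diagonal n c k₁
... | tri> _ _ k₂<k₁ = [ inj₁ ∘ swap , inj₂ ∘ inj₂ ∘ swap ]′ (outside-window k₂<k₁ λ (k₂≤n , c<k₁) →
        Bell≥-no-injection G colouring k₂<k₁ k₂≤n c<k₁ (↔⇒↣ (↔-sym bij)))
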